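{- For every integer $k\ge 4$, there is a $C_4$-free graph $H$ with clique partition number $\theta(H)=k$ that admits a frozen $(k+1)$-clique-partition.
   Context: A $k$-clique-partition of a graph $H$ is a partition of $V(H)$ into at most $k$ (ordered, possibly empty) cliques; $\theta(H)$ is the least $k$ for which $H$ has a $k$-clique-partition. A $k$-clique-partition is frozen if every vertex $v$ has a non-neighbour in each of the $k$ cliques other than the one containing $v$. $H$ is $C_4$-free if no induced subgraph of $H$ is a cycle on four vertices. -}

module Defs where

open import Data.Nat using (ℕ; _<_)
open import Data.Fin using (Fin)
open import Data.Bool using (Bool; true; false)
open import Data.Product using (Σ; _×_; ∃; ∃-syntax)
open import Relation.Nullary using (¬_)
open import Data.Empty using (⊥)
open import Relation.Binary.PropositionalEquality using (_≡_; _≢_)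

record Graph : Set where
  field
    n     : ℕ
    adj   : Fin n → Fin n → Bool
    sym   : ∀ u v → adj u v ≡ adj v u
    irrfl : ∀ v → adj v v ≡ false

open Graph public

Vertex : Graph → Set
Vertex H = Fin (n H)

Adj : (H : Graph) → Vertex H → Vertex H → Set
Adj H u v = adj H u v ≡ true

C4Free : Graph → Set
C4Free H = ∀ (a b c d : Vertex H) →
  a ≢ b → a ≢ c → a ≢ d → b ≢ c → b ≢ d → c ≢ d →
  Adj H a b → Adj H b c → Adj H c d → Adj H d a →
  ¬ Adj H a c → ¬ Adj H b d → ⊥

-- A k-clique-partition: an assignment of each vertex to one of k
-- (ordered, possibly empty) classes, each class a clique.
IsCliquePartition : (H : Graph) (k : ℕ) → (Vertex H → Fin k) → Set
IsCliquePartition H k c = ∀ u v → u ≢ v → c u ≡ c v → Adj H u v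

CliquePartition : Graph → ℕ → Set
CliquePartition H k = Σ (Vertex H → Fin k) (IsCliquePartition H k)

θ≡ : Graph → ℕ → Set
θ≡ H k = CliquePartition H k × (∀ m → m < k → ¬ CliquePartition H m)

IsFrozen : (H : Graph) (k : ℕ) → (Vertex H → Fin k) → Set
IsFrozen H k c = ∀ (v : Vertex H) (j : Fin k) → j ≢ c v →
  ∃[ u ] (c u ≡ j × ¬ Adj H u v)

{-# OPTIONS --safe #-}
module Submission where

-- On ten vertices a i, b i (i < 5) take the triangles a₀a₁a₂ and a₃a₄b₂, the matching
-- a i b i, and the edges b₀b₃, b₁b₄. This graph is C4-free, the pairs {a i, b i} form a
-- frozen 5-clique-partition, and θ = 4: there is a 4-clique-partition and an independent
-- set a₀, b₁, b₂, b₃. Adding an isolated vertex raises θ by exactly one, since that vertex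
-- needs a clique of its own, and keeps the graph C4-free and the partition frozen when the
-- new vertex becomes a new class.

open import Defs
open import Data.Nat using (ℕ; zero; suc; _+_; _≤_; _<_; s≤s; z≤n)
open import Data.Product using (_×_; _,_; ∃; ∃-syntax)
open import Data.Bool as Bool using (Bool; true; false; _∨_; _∧_)
open import Data.Empty using (⊥-elim)
open import Data.Fin as Fin using (Fin; zero; suc; punchOut; splitAt; _↑ˡ_; _↑ʳ_)
open import Data.Fin.Patterns using (0F; 1F; 2F; 3F; 4F)
open import Data.Fin.Properties using (all?; any?; pigeonhole; <⇒≢; suc-injective; punchOut-injective)
open import Data.List using (List; _∷_; [])
open import Data.Bool.ListAction using (any)
open import Data.Sum using ([_,_]′)
open import Data.Vec using (lookup; _∷_; [])
open import Function using (_∘_; id; case_of_)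
open import Relation.Nullary using (¬_; Dec; yes; no; ⌊_⌋)
open import Relation.Nullary.Decidable using (toWitness; ¬?; _→-dec_; _×-dec_)
open import Relation.Binary.PropositionalEquality using (_≡_; _≢_; refl; cong)

addIsolated : Graph → Graph
addIsolated H = record { n = suc (n H) ; adj = adj⁺ ; sym = sym⁺ ; irrfl = irrfl⁺ }
  where
  adj⁺ : Fin (suc (n H)) → Fin (suc (n H)) → Bool
  adj⁺ zero    _       = false
  adj⁺ (suc _) zero    = false
  adj⁺ (suc u) (suc v) = adj H u v

  sym⁺ : ∀ u v → adj⁺ u v ≡ adj⁺ v u
  sym⁺ zero    zero    = refl
  sym⁺ zero    (suc v) = refl
  sym⁺ (suc u) zero    = refl
  sym⁺ (suc u) (suc v) = sym H u v

  irrfl⁺ : ∀ v → adj⁺ v v ≡ false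
  irrfl⁺ zero    = refl
  irrfl⁺ (suc v) = irrfl H v

module _ {H : Graph} where

  C4Free-addIsolated : C4Free H → C4Free (addIsolated H)
  C4Free-addIsolated c4 zero    _       _       _       _ _ _ _ _ _ () _  _  _
  C4Free-addIsolated c4 (suc a) zero    _       _       _ _ _ _ _ _ () _  _  _
  C4Free-addIsolated c4 (suc a) (suc b) zero    _       _ _ _ _ _ _ _  () _  _
  C4Free-addIsolated c4 (suc a) (suc b) (suc c) zero    _ _ _ _ _ _ _  _  () _
  C4Free-addIsolated c4 (suc a) (suc b) (suc c) (suc d) a≢b a≢c a≢d b≢c b≢d c≢d =
    c4 a b c d (↓ a≢b) (↓ a≢c) (↓ a≢d) (↓ b≢c) (↓ b≢d) (↓ c≢d)
    where
    ↓ : ∀ {m} {x y : Fin m} → Fin.suc x ≢ suc y → x ≢ y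
    ↓ sx≢sy = sx≢sy ∘ cong suc

  extendPartition : ∀ {k} → (Vertex H → Fin k) → Vertex (addIsolated H) → Fin (suc k)
  extendPartition c zero    = zero
  extendPartition c (suc u) = suc (c u)

  isCliquePartition-addIsolated : ∀ {k c} → IsCliquePartition H k c →
    IsCliquePartition (addIsolated H) (suc k) (extendPartition c)
  isCliquePartition-addIsolated isCP zero    zero    0≢0 _  = ⊥-elim (0≢0 refl)
  isCliquePartition-addIsolated isCP (suc u) (suc v) u≢v eq =
    isCP u v (u≢v ∘ cong suc) (suc-injective eq)

  -- The isolated vertex is alone in its clique, so deleting it frees one class.
  cliquePartition-removeIsolated : ∀ {m} →
    CliquePartition (addIsolated H) (suc m) → CliquePartition H m
  cliquePartition-removeIsolated (c , isCP) = c′ , isCP′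
    where
    isolated : ∀ u → c zero ≢ c (suc u)
    isolated u eq = case isCP zero (suc u) (λ ()) eq of λ ()

    c′ : Vertex H → Fin _
    c′ u = punchOut (isolated u)

    isCP′ : IsCliquePartition H _ c′
    isCP′ u v u≢v eq =
      isCP (suc u) (suc v) (u≢v ∘ suc-injective) (punchOut-injective (isolated u) (isolated v) eq)

  θ≡-addIsolated : ∀ {k} → θ≡ H k → θ≡ (addIsolated H) (suc k)
  θ≡-addIsolated ((c , isCP) , minimal) =
    (extendPartition c , isCliquePartition-addIsolated isCP) , minimal⁺
    where
    minimal⁺ : ∀ m → m < suc _ → ¬ CliquePartition (addIsolated H) m
    minimal⁺ zero    _         (c⁺ , _) = case c⁺ zero of λ ()
    minimal⁺ (suc m) (s≤s m<k) P        = minimal m m<k (cliquePartition-removeIsolated P)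

  θ≡-suc⇒Vertex : ∀ {k} → θ≡ H (suc k) → Vertex H
  θ≡-suc⇒Vertex (_ , minimal) =
    inhabited (n H) λ c → minimal 0 (s≤s z≤n) (c , λ u → case c u of λ ())
    where
    inhabited : ∀ m → ¬ (Fin m → Fin 0) → Fin m
    inhabited zero    noMap = ⊥-elim (noMap id)
    inhabited (suc m) _     = zero

  isFrozen⇒classesInhabited : ∀ {k c} → Vertex H → IsFrozen H k c → ∀ j → ∃[ u ] c u ≡ j
  isFrozen⇒classesInhabited {c = c} v frozen j with j Fin.≟ c v
  ... | yes refl = v , refl
  ... | no  j≢cv = let u , cu≡j , _ = frozen v j j≢cv in u , cu≡j

  isFrozen-addIsolated : ∀ {k c} → Vertex H → IsFrozen H k c →
    IsFrozen (addIsolated H) (suc k) (extendPartition c)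
  isFrozen-addIsolated v frozen zero    zero    0≢0  = ⊥-elim (0≢0 refl)
  isFrozen-addIsolated v frozen zero    (suc j) _    =
    let u , cu≡j = isFrozen⇒classesInhabited v frozen j in suc u , cong suc cu≡j , λ ()
  isFrozen-addIsolated v frozen (suc w) zero    _    = zero , refl , λ ()
  isFrozen-addIsolated v frozen (suc w) (suc j) j≢cw =
    let u , cu≡j , u≁w = frozen w j (j≢cw ∘ cong suc) in suc u , cong suc cu≡j , u≁w

IsIndependentSet : (H : Graph) {k : ℕ} → (Fin k → Vertex H) → Set
IsIndependentSet H f = ∀ i j → i ≢ j → f i ≢ f j × ¬ Adj H (f i) (f j)

independentSet⇒¬cliquePartition : ∀ {H k m} {f : Fin k → Vertex H} →
  IsIndependentSet H f → m < k → ¬ CliquePartition H m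
independentSet⇒¬cliquePartition {f = f} independent m<k (c , isCP) =
  let i , j , i<j , same = pigeonhole m<k (c ∘ f)
      fi≢fj , fi≁fj = independent i j (<⇒≢ i<j)
  in fi≁fj (isCP (f i) (f j) fi≢fj same)

module Base where

  a b : Fin 5 → Fin 10
  a i = i ↑ˡ 5
  b i = 5 ↑ʳ i

  edges : List (Fin 10 × Fin 10)
  edges = (a 0F , a 1F) ∷ (a 0F , a 2F) ∷ (a 1F , a 2F) ∷
          (a 3F , a 4F) ∷ (a 3F , b 2F) ∷ (a 4F , b 2F) ∷
          (a 0F , b 0F) ∷ (a 1F , b 1F) ∷ (a 2F , b 2F) ∷ (a 3F , b 3F) ∷ (a 4F , b 4F) ∷
          (b 0F , b 3F) ∷ (b 1F , b 4F) ∷ []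

  adjacent : Fin 10 → Fin 10 → Bool
  adjacent u v = any joins edges
    where
    joins : Fin 10 × Fin 10 → Bool
    joins (x , y) = (⌊ u Fin.≟ x ⌋ ∧ ⌊ v Fin.≟ y ⌋) ∨ (⌊ u Fin.≟ y ⌋ ∧ ⌊ v Fin.≟ x ⌋)

  graph : Graph
  graph = record
    { n     = 10
    ; adj   = adjacent
    ; sym   = toWitness {a? = all? λ u → all? λ v → adjacent u v Bool.≟ adjacent v u} _
    ; irrfl = toWitness {a? = all? λ v → adjacent v v Bool.≟ false} _
    }

  Adj? : ∀ u v → Dec (Adj graph u v)
  Adj? u v = adjacent u v Bool.≟ true

  byHalves : ∀ {k} → (Fin 5 → Fin k) → (Fin 5 → Fin k) → Fin 10 → Fin k
  byHalves f g = [ f , g ]′ ∘ splitAt 5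

  isCliquePartition? : ∀ {k} (c : Fin 10 → Fin k) → Dec (IsCliquePartition graph k c)
  isCliquePartition? c =
    all? λ u → all? λ v → ¬? (u Fin.≟ v) →-dec (c u Fin.≟ c v →-dec Adj? u v)

  pairs : Fin 10 → Fin 5
  pairs = byHalves id id

  fourCliques : Fin 10 → Fin 4
  fourCliques = byHalves (lookup (0F ∷ 0F ∷ 0F ∷ 1F ∷ 1F ∷ [])) (lookup (2F ∷ 3F ∷ 1F ∷ 2F ∷ 3F ∷ []))

  fourIndependent : Fin 4 → Fin 10
  fourIndependent = lookup (a 0F ∷ b 1F ∷ b 2F ∷ b 3F ∷ [])

  C4Free-graph : C4Free graph
  C4Free-graph = toWitness {a? = all? λ w → all? λ x → all? λ y → all? λ z →
    ¬? (w Fin.≟ x) →-dec (¬? (w Fin.≟ y) →-dec (¬? (w Fin.≟ z) →-dec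
    (¬? (x Fin.≟ y) →-dec (¬? (x Fin.≟ z) →-dec (¬? (y Fin.≟ z) →-dec
    (Adj? w x →-dec (Adj? x y →-dec (Adj? y z →-dec (Adj? z w →-dec
    (¬? (Adj? w y) →-dec (¬? (Adj? x z) →-dec no id)))))))))))} _

  θ≡4 : θ≡ graph 4
  θ≡4 = (fourCliques , toWitness {a? = isCliquePartition? fourCliques} _) ,
        λ _ → independentSet⇒¬cliquePartition {H = graph} independent
    where
    independent : IsIndependentSet graph fourIndependent
    independent = toWitness {a? = all? λ i → all? λ j → ¬? (i Fin.≟ j) →-dec
      (¬? (fourIndependent i Fin.≟ fourIndependent j) ×-dec
       ¬? (Adj? (fourIndependent i) (fourIndependent j)))} _

  isCliquePartition-pairs : IsCliquePartition graph 5 pairs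
  isCliquePartition-pairs = toWitness {a? = isCliquePartition? pairs} _

  isFrozen-pairs : IsFrozen graph 5 pairs
  isFrozen-pairs = toWitness {a? = all? λ v → all? λ j → ¬? (j Fin.≟ pairs v) →-dec
    any? λ u → (pairs u Fin.≟ j) ×-dec ¬? (Adj? u v)} _

C4FreeFrozenAboveθ : ℕ → Set
C4FreeFrozenAboveθ k = ∃[ H ] (C4Free H × θ≡ H k ×
  ∃[ c ] (IsCliquePartition H (suc k) c × IsFrozen H (suc k) c))

c4FreeFrozenAboveθ-4 : C4FreeFrozenAboveθ 4
c4FreeFrozenAboveθ-4 =
  Base.graph , Base.C4Free-graph , Base.θ≡4 , Base.pairs , Base.isCliquePartition-pairs , Base.isFrozen-pairs

c4FreeFrozenAboveθ-suc : ∀ {k} → C4FreeFrozenAboveθ (suc k) → C4FreeFrozenAboveθ (suc (suc k))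
c4FreeFrozenAboveθ-suc (H , c4 , θH , c , isCP , frozen) =
  addIsolated H , C4Free-addIsolated c4 , θ≡-addIsolated θH ,
  extendPartition c , isCliquePartition-addIsolated isCP ,
  isFrozen-addIsolated (θ≡-suc⇒Vertex {H = H} θH) frozen

theorem16 : ∀ (k : ℕ) → 4 ≤ k →
    ∃[ H ] (C4Free H × θ≡ H k ×
      ∃[ c ] (IsCliquePartition H (suc k) c × IsFrozen H (suc k) c))
theorem16 (suc (suc (suc (suc j)))) (s≤s (s≤s (s≤s (s≤s _)))) = c4FreeFrozenAboveθ j
  where
  c4FreeFrozenAboveθ : ∀ j → C4FreeFrozenAboveθ (4 + j)
  c4FreeFrozenAboveθ zero    = c4FreeFrozenAboveθ-4
  c4FreeFrozenAboveθ (suc j) = c4FreeFrozenAboveθ-suc (c4FreeFrozenAboveθ j)
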